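{- If $G$ is a bipartite graph, then $\operatorname{hn}(G) = \operatorname{hn}(G_{C_4})$.
   Context: For an undirected graph $G$: $I_G(S)$ is the set of vertices lying on some shortest $u$–$v$ path with $u,v \in S$ (and $I_G(S)=S$ if $|S|\le 1$); $S$ is convex if $I_G(S)=S$; the hull of $S$ is the smallest convex set containing it; a hull set is a set whose hull is $V(G)$; $\operatorname{hn}(G)$ is the minimum size of a hull set. The same notions for an oriented graph $D$ are defined using directed geodesics (directed $(u,v)$-paths with minimum number of arcs, for all ordered pairs $u,v\in S$), giving $\operatorname{hn}(D)$. Given a graph $G$ with $V(G)=\{v_1,\dots,v_n\}$, $G_{C_4}$ is the oriented graph with vertex set $V(G) \cup \{v_{i,j}, v_{j,i} : v_iv_j \in E(G)\}$ and arc set $\{(v_i,v_{i,j}),(v_{i,j},v_j),(v_j,v_{j,i}),(v_{j,i},v_i) : v_iv_j \in E(G)\}$; i.e. each edge of $G$ is replaced by a directed $4$-cycle. -}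

module Defs where

open import Data.Nat using (ℕ; zero; suc; _<_; _≤_)
open import Data.Fin using (Fin)
open import Data.Bool using (Bool; T)
open import Data.List using (List; length)
open import Data.List.Membership.Propositional using (_∈_)
open import Data.List.Relation.Unary.Unique.Propositional using (Unique)
open import Data.Product using (Σ; ∃; ∃-syntax; _×_; _,_)
open import Data.Sum using (_⊎_)
open import Relation.Nullary using (¬_)
open import Relation.Binary.PropositionalEquality using (_≡_; _≢_)
open import Level using (Level; _⊔_) renaming (suc to lsuc; zero to lzero)

-- Finite simple (undirected) graphs on vertex set Fin n.
-- Adjacency is Bool-valued so that each edge is a single (proof-irrelevant) datum.

record Graph (n : ℕ) : Set where
  field
    adj    : Fin n → Fin n → Bool
    sym    : ∀ i j → T (adj i j) → T (adj j i)
    irrefl : ∀ i → ¬ T (adj i i)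

open Graph public

Edge : ∀ {n} → Graph n → Fin n → Fin n → Set
Edge G i j = T (adj G i j)

Bipartite : ∀ {n} → Graph n → Set
Bipartite {n} G = Σ (Fin n → Bool) λ c → ∀ i j → Edge G i j → c i ≢ c j

-- Generic (directed) walks for an arc relation A on a vertex type V.
-- For an undirected graph, take A to be the symmetric edge relation.

module _ {V : Set} (A : V → V → Set) where

  data Walk : V → V → ℕ → Set where
    []  : ∀ {u} → Walk u u 0
    _∷_ : ∀ {u w v k} → A u w → Walk w v k → Walk u v (suc k)

  data OnWalk (x : V) : ∀ {u v k} → Walk u v k → Set where
    here  : ∀ {v k} {w : Walk x v k} → OnWalk x w
    there : ∀ {u w' v k} {a : A u w'} {w : Walk w' v k} → OnWalk x w → OnWalk x (a ∷ w)

  -- A (u,v)-walk of length k is a geodesic if no (u,v)-walk is shorter.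
  -- (A shortest walk is necessarily a path.)
  IsGeodesic : ∀ {u v k} → Walk u v k → Set
  IsGeodesic {u} {v} {k} _ = ∀ m → m < k → ¬ Walk u v m

  -- Geodetic interval I(S): vertices on some geodesic between (ordered pairs of)
  -- vertices of S.  (For |S| ≤ 1 this is S, since the only u-u geodesic is trivial.)
  Interval : (V → Set) → V → Set
  Interval S x = ∃[ u ] ∃[ v ] (S u × S v ×
                 ∃[ k ] Σ (Walk u v k) λ w → IsGeodesic w × OnWalk x w)

  Convex : (V → Set) → Set
  Convex C = ∀ x → Interval C x → C x

  -- S is a hull set iff the smallest convex set containing S is all of V,
  -- i.e. every convex set containing S is all of V.
  HullSet : List V → Set₁
  HullSet S = (C : V → Set) → Convex C → (∀ x → x ∈ S → C x) → ∀ x → C x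

  HullNumber : ℕ → Set₁
  HullNumber k = (∃[ S ] (Unique S × length S ≡ k × HullSet S))
               × (∀ S → Unique S → HullSet S → k ≤ length S)

-- The oriented graph G_{C4}: every edge v_i v_j replaced by the directed
-- 4-cycle v_i → v_{i,j} → v_j → v_{j,i} → v_i.

module _ {n : ℕ} (G : Graph n) where

  data C4Vertex : Set where
    orig : Fin n → C4Vertex
    sub  : (i j : Fin n) → Edge G i j → C4Vertex

  data C4Arc : C4Vertex → C4Vertex → Set where
    out : ∀ i j (e : Edge G i j) → C4Arc (orig i) (sub i j e)
    inn : ∀ i j (e : Edge G i j) → C4Arc (sub i j e) (orig j)

hnG : ∀ {n} → Graph n → ℕ → Set₁
hnG G k = HullNumber (Edge G) k

hnGC4 : ∀ {n} → Graph n → ℕ → Set₁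
hnGC4 G k = HullNumber (C4Arc G) k

module Submission where

-- Write E for the edges of G and D for the arcs of G_{C4}.  A G-walk of
-- length k embeds as a D-walk of length 2k, and every D-walk projects to a
-- G-walk of half its length (up to a subdivision vertex at either end), so
-- geodesics correspond.  After generic facts on walks, geodesics, hull sets,
-- least witnesses, doubling and parity, and this walk correspondence:
--  * Lifting: a hull set S of G is a hull set of G_{C4}; the trace on V(G) of
--    a D-convex set is E-convex and each v_{i,j} is between v_i and v_j.
--  * Projecting: a hull set of G_{C4} of original vertices is a hull set of G,
--    as an E-convex set C extends to a D-convex one (add v_{i,j} if v_i, v_j ∈ C).
--  * Exchange (uses bipartiteness): a vertex v_{x,y} of a hull set can be
--    replaced by whichever of v_x, v_y is farther from the rest, since by
--    parity the nearer one lies on a geodesic towards the farther one.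

open import Defs
open import Data.Nat using (ℕ; zero; suc; _+_; _<_; _≤_; z≤n; s≤s)
open import Data.Nat.Properties
  using (+-suc; +-identityʳ; +-assoc; +-monoʳ-<; +-monoˡ-<; +-cancelˡ-<; ≤-antisym; ≤-trans; ≤-reflexive;
         m<1+n⇒m<n∨m≡n; anyUpTo?; module ≤-Reasoning)
open import Data.Nat.Induction using (<-rec)
open import Data.Nat.GeneralisedArithmetic using (iterate)
open import Data.Fin using (Fin) renaming (_≟_ to _≟ᶠ_)
open import Data.Fin.Properties using (any?)
open import Data.Bool using (Bool; not; T?)
open import Data.Bool.Properties using (¬-not)
open import Data.List using (List; []; _∷_; map; length; _++_; deduplicate)
open import Data.List.Properties using (length-map; ++-identityʳ; length-deduplicate)
open import Data.List.Membership.Propositional using (_∈_)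
open import Data.List.Membership.Propositional.Properties using (∈-map⁺; ∈-map⁻; ∈-deduplicate⁺)
open import Data.List.Relation.Unary.Any using (here; there)
open import Data.List.Relation.Unary.Unique.Propositional using (Unique)
import Data.List.Relation.Unary.Unique.Propositional.Properties as Unique
open import Data.List.Relation.Unary.Unique.DecPropositional.Properties using (deduplicate-!)
open import Data.List.Relation.Binary.Subset.Propositional using (_⊆_)
open import Data.List.Relation.Binary.Permutation.Propositional using (_↭_; ↭-sym)
open import Data.List.Relation.Binary.Permutation.Propositional.Properties using (∈-resp-↭; shift)
open import Data.Product using (Σ; ∃-syntax; _×_; _,_; proj₁; proj₂)
open import Data.Sum using (_⊎_; inj₁; inj₂)
open import Data.Empty using (⊥-elim)
open import Relation.Nullary using (¬_; Dec; yes; no)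
open import Relation.Nullary.Decidable using (_×-dec_; _⊎-dec_)
open import Relation.Binary.PropositionalEquality
  using (_≡_; _≢_; refl; trans; cong; subst; ≢-sym)
  renaming (sym to ≡-sym)

module WalkFacts {V : Set} (A : V → V → Set) where

  infixr 5 _++ʷ_
  infixl 5 _∷ʳ_

  _++ʷ_ : ∀ {u v w k l} → Walk A u v k → Walk A v w l → Walk A u w (k + l)
  [] ++ʷ q = q
  (a ∷ p) ++ʷ q = a ∷ (p ++ʷ q)

  _∷ʳ_ : ∀ {u v w k} → Walk A u v k → A v w → Walk A u w (suc k)
  [] ∷ʳ a = a ∷ []
  (b ∷ p) ∷ʳ a = b ∷ (p ∷ʳ a)

  on-∷ʳ : ∀ {u v w k} (p : Walk A u v k) (a : A v w) → OnWalk A v (p ∷ʳ a)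
  on-∷ʳ [] a = here
  on-∷ʳ (b ∷ p) a = there (on-∷ʳ p a)

  on-++ʳ : ∀ {x u v w k l} (p : Walk A u v k) {q : Walk A v w l} → OnWalk A x q → OnWalk A x (p ++ʷ q)
  on-++ʳ [] o = o
  on-++ʳ (a ∷ p) o = there (on-++ʳ p o)

  splitAt : ∀ {x u v k} (p : Walk A u v k) → OnWalk A x p →
            ∃[ k₁ ] ∃[ k₂ ] (Walk A u x k₁ × Walk A x v k₂ × k₁ + k₂ ≡ k)
  splitAt {k = k} p here = 0 , k , [] , p , refl
  splitAt (a ∷ p) (there o) with splitAt p o
  ... | k₁ , k₂ , p₁ , p₂ , eq = suc k₁ , k₂ , a ∷ p₁ , p₂ , cong suc eq

  Reach : V → V → Set
  Reach u v = ∃[ k ] Walk A u v k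

  reach-trans : ∀ {u v w} → Reach u v → Reach v w → Reach u w
  reach-trans (k , p) (l , q) = k + l , p ++ʷ q

  geodesic-loop : ∀ {x u k} (p : Walk A u u k) → IsGeodesic A p → OnWalk A x p → x ≡ u
  geodesic-loop [] _ here = refl
  geodesic-loop (a ∷ p) geo _ = ⊥-elim (geo 0 (s≤s z≤n) [])

  hullSet-⊆ : ∀ {S S'} → HullSet A S → S ⊆ S' → HullSet A S'
  hullSet-⊆ hull S⊆S' C convex S'⊆C = hull C convex (λ x x∈S → S'⊆C x (S⊆S' x∈S))

  hullSet-↭ : ∀ {S S'} → HullSet A S → S ↭ S' → HullSet A S'
  hullSet-↭ hull σ = hullSet-⊆ hull (∈-resp-↭ σ)

  module Reversible (reverseArc : ∀ {u v} → A u v → Reach v u) where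

    reverse : ∀ {u v k} → Walk A u v k → Reach v u
    reverse [] = 0 , []
    reverse (a ∷ p) = reach-trans (reverse p) (reverseArc a)

    ReachableFrom : V → List V → V → Set
    ReachableFrom t R x = x ≡ t ⊎ ∃[ r ] (r ∈ R × Reach r x)

    reachableFrom-convex : ∀ t R → Convex A (ReachableFrom t R)
    reachableFrom-convex t R x (_ , _ , inj₂ (r , r∈R , ρ) , _ , _ , p , _ , on)
      with splitAt p on
    ... | k₁ , _ , p₁ , _ , _ = inj₂ (r , r∈R , reach-trans ρ (k₁ , p₁))
    reachableFrom-convex t R x (_ , _ , inj₁ refl , inj₂ (r , r∈R , ρ) , _ , p , _ , on)
      with splitAt p on
    ... | _ , _ , _ , p₂ , _ = inj₂ (r , r∈R , reach-trans ρ (reverse p₂))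
    reachableFrom-convex t R x (_ , _ , inj₁ refl , inj₁ refl , _ , p , geo , on) =
      inj₁ (geodesic-loop p geo on)

minimal : ∀ {P : ℕ → Set} → (∀ m → Dec (P m)) → ∀ {K} → P K →
          ∃[ m ] (P m × (∀ j → j < m → ¬ P j))
minimal {P} P? {K} = <-rec (λ K → P K → ∃[ m ] (P m × (∀ j → j < m → ¬ P j))) search K
  where
  search : ∀ K → (∀ {j} → j < K → P j → ∃[ m ] (P m × (∀ i → i < m → ¬ P i))) →
           P K → ∃[ m ] (P m × (∀ j → j < m → ¬ P j))
  search K smaller pK with anyUpTo? P? K
  ... | yes (j , j<K , pj) = smaller j<K pj
  ... | no none = K , pK , λ j j<K pj → none (j , j<K , pj)

walk? : ∀ {n} {A : Fin n → Fin n → Set} → (∀ u v → Dec (A u v)) → ∀ m u v → Dec (Walk A u v m)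
walk? A? zero u v with u ≟ᶠ v
... | yes refl = yes []
... | no u≢v = no λ { [] → u≢v refl }
walk? A? (suc m) u v with any? (λ w → A? u w ×-dec walk? A? m w v)
... | yes (w , a , p) = yes (a ∷ p)
... | no none = no λ { (a ∷ p) → none (_ , a , p) }

double : ℕ → ℕ
double zero = zero
double (suc k) = suc (suc (double k))

double-mono-< : ∀ {h k} → h < k → double h < double k
double-mono-< {zero} {suc k} _ = s≤s z≤n
double-mono-< {suc h} {suc k} (s≤s h<k) = s≤s (s≤s (double-mono-< h<k))

double-cancel-< : ∀ {h k} → double h < double k → h < k
double-cancel-< {zero} {suc k} _ = s≤s z≤n
double-cancel-< {suc h} {suc k} (s≤s (s≤s lt)) = s≤s (double-cancel-< lt)

double-+ : ∀ a b → double (a + b) ≡ double a + double b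
double-+ zero b = refl
double-+ (suc a) b = cong (λ d → suc (suc d)) (double-+ a b)

-- Lengths of D-walks framed by at most one subdivision vertex at each end.
framed-< : ∀ a b {m h₁ h₂} → m < h₁ + h₂ → a + (double m + b) < (a + double h₁) + (double h₂ + b)
framed-< a b {m} {h₁} {h₂} m<h = begin-strict
  a + (double m + b)                  <⟨ +-monoʳ-< a (+-monoˡ-< b (double-mono-< m<h)) ⟩
  a + (double (h₁ + h₂) + b)          ≡⟨ cong (λ d → a + (d + b)) (double-+ h₁ h₂) ⟩
  a + ((double h₁ + double h₂) + b)   ≡⟨ cong (a +_) (+-assoc (double h₁) (double h₂) b) ⟩
  a + (double h₁ + (double h₂ + b))   ≡⟨ ≡-sym (+-assoc a (double h₁) (double h₂ + b)) ⟩
  (a + double h₁) + (double h₂ + b)   ∎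
  where open ≤-Reasoning

module Parity {n : ℕ} (G : Graph n) (colour : Fin n → Bool)
              (proper : ∀ i j → Edge G i j → colour i ≢ colour j) where

  open WalkFacts (Edge G) using (_∷ʳ_)

  colour-along : ∀ {u v m} → Walk (Edge G) u v m → colour v ≡ iterate not (colour u) m
  colour-along [] = refl
  colour-along (_∷_ {u} {w} {k = k} e p) =
    trans (colour-along p) (cong (λ c → iterate not c k) (¬-not (≢-sym (proper u w e))))

  -- If x is a nearest endpoint of the edge xy seen from u, then a shortest
  -- walk to x followed by the edge is a geodesic to y: a walk to y of the same
  -- length as one to x would give x and y the same colour.
  extend-nearest : ∀ {u x y m} (g : Walk (Edge G) u x m) (e : Edge G x y) →
                   (∀ j → j < m → ¬ Walk (Edge G) u y j) → IsGeodesic (Edge G) (g ∷ʳ e)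
  extend-nearest {x = x} {y} g e nearer j j<1+m p with m<1+n⇒m<n∨m≡n j<1+m
  ... | inj₁ j<m = nearer j j<m p
  ... | inj₂ refl = proper x y e (trans (colour-along g) (≡-sym (colour-along p)))

module C4 {n : ℕ} (G : Graph n) where

  E : Fin n → Fin n → Set
  E = Edge G

  D : C4Vertex G → C4Vertex G → Set
  D = C4Arc G

  open WalkFacts D using (_++ʷ_; on-++ʳ; splitAt; Reach; hullSet-↭)
  open WalkFacts E using () renaming (_++ʷ_ to _++ᴱ_; on-++ʳ to on-++ᴱ)

  orig-injective : ∀ {x y : Fin n} → orig {G = G} x ≡ orig y → x ≡ y
  orig-injective refl = refl

  -- The original vertex at which one enters, resp. leaves, a vertex of G_{C4},
  -- and the number of arcs needed for that (v_i → v_{i,j} → v_j).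
  entry exit : C4Vertex G → Fin n
  entry (orig w) = w
  entry (sub i j _) = i
  exit (orig w) = w
  exit (sub i j _) = j

  offset : C4Vertex G → ℕ
  offset (orig _) = 0
  offset (sub _ _ _) = 1

  leave : ∀ p → Walk D p (orig (exit p)) (offset p)
  leave (orig a) = []
  leave (sub i j e) = inn i j e ∷ []

  enter : ∀ q → Walk D (orig (entry q)) q (offset q)
  enter (orig a) = []
  enter (sub i j e) = out i j e ∷ []

  embed : ∀ {u v k} → Walk E u v k → Walk D (orig u) (orig v) (double k)
  embed [] = []
  embed (_∷_ {u} {w} e p) = out u w e ∷ (inn u w e ∷ embed p)

  on-embed : ∀ {x u v k} (p : Walk E u v k) → OnWalk E x p → OnWalk D (orig x) (embed p)
  on-embed p here = here
  on-embed (e ∷ p) (there o) = there (there (on-embed p o))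

  projectFrom : ∀ {u q L} → Walk D (orig u) q L → ∃[ h ] (Walk E u (entry q) h × L ≡ double h + offset q)
  projectFrom [] = 0 , [] , refl
  projectFrom (out i j e ∷ []) = 0 , [] , refl
  projectFrom (out i j e ∷ (inn _ _ _ ∷ p)) with projectFrom p
  ... | h , g , eq = suc h , e ∷ g , cong (λ d → suc (suc d)) eq

  projectTo : ∀ {p v L} → Walk D p (orig v) L → ∃[ h ] (Walk E (exit p) v h × L ≡ offset p + double h)
  projectTo {orig a} p with projectFrom p
  ... | h , g , eq = h , g , trans eq (+-identityʳ (double h))
  projectTo {sub i j e} (inn _ _ _ ∷ p) with projectTo p
  ... | h , g , eq = h , g , cong suc eq

  embedFrom-geodesic : ∀ p {v m} (g : Walk E (exit p) v m) → IsGeodesic E g →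
                       IsGeodesic D (leave p ++ʷ embed g)
  embedFrom-geodesic p {m = m} g geo L L<len q with projectTo q
  ... | h , g' , refl = geo h (double-cancel-< (+-cancelˡ-< (offset p) (double h) (double m) L<len)) g'

  sub-between : (C : C4Vertex G → Set) → Convex D C →
                ∀ i j e → C (orig i) → C (orig j) → C (sub i j e)
  sub-between C convex i j e ci cj =
    convex _ (orig i , orig j , ci , cj , 2 , out i j e ∷ (inn i j e ∷ []) , geodesic , there here)
    where
    geodesic : IsGeodesic D (out i j e ∷ (inn i j e ∷ []))
    geodesic zero _ [] = irrefl G i e
    geodesic (suc zero) _ (() ∷ [])
    geodesic (suc (suc m)) (s≤s (s≤s ()))

  sub-preceded : ∀ {p q k i j e} (W : Walk D p q k) → OnWalk D (sub i j e) W →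
                 p ≡ sub i j e ⊎ OnWalk D (orig i) W
  sub-preceded W here = inj₁ refl
  sub-preceded (a ∷ W) (there o) with sub-preceded W o
  sub-preceded (out _ _ _ ∷ W) (there o) | inj₁ refl = inj₂ here
  ... | inj₂ o' = inj₂ (there o')

  sub-followed : ∀ {p q k i j e} (W : Walk D p q k) → OnWalk D (sub i j e) W →
                 q ≡ sub i j e ⊎ OnWalk D (orig j) W
  sub-followed [] here = inj₁ refl
  sub-followed (inn _ _ _ ∷ W) here = inj₂ (there here)
  sub-followed (a ∷ W) (there o) with sub-followed W o
  ... | inj₁ q≡ = inj₁ q≡
  ... | inj₂ o' = inj₂ (there o')

  -- Hull sets of G lift to G_{C4}

  lift-hullSet : ∀ S → HullSet E S → HullSet D (map orig S)
  lift-hullSet S hull C convex S⊆C = everywhere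
    where
    trace : Fin n → Set
    trace x = C (orig x)

    trace-convex : Convex E trace
    trace-convex z (u , v , cu , cv , k , g , geo , on) =
      convex (orig z) (orig u , orig v , cu , cv , double k , embed g , embedFrom-geodesic (orig u) g geo , on-embed g on)

    originals : ∀ x → trace x
    originals = hull trace trace-convex (λ x x∈S → S⊆C (orig x) (∈-map⁺ orig x∈S))

    everywhere : ∀ x → C x
    everywhere (orig x) = originals x
    everywhere (sub i j e) = sub-between C convex i j e (originals i) (originals j)

  -- Hull sets of G_{C4} made of original vertices project to G

  module Extension (C : Fin n → Set) (convex : Convex E C) where

    C⁺ : C4Vertex G → Set
    C⁺ (orig x) = C x
    C⁺ (sub i j _) = C i × C j

    exit∈C : ∀ p → C⁺ p → C (exit p)
    exit∈C (orig a) c = c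
    exit∈C (sub i j e) c = proj₂ c

    entry∈C : ∀ q → C⁺ q → C (entry q)
    entry∈C (orig a) c = c
    entry∈C (sub i j e) c = proj₁ c

    -- An original vertex on a D-geodesic between p and q lies on a G-geodesic
    -- from the exit of p to the entry of q.
    orig-on-geodesic : ∀ {p q k c} (W : Walk D p q k) → IsGeodesic D W → OnWalk D (orig c) W →
                       C⁺ p → C⁺ q → C c
    orig-on-geodesic {p} {q} {k} {c} W geo on cp cq with splitAt W on
    ... | k₁ , k₂ , W₁ , W₂ , k₁+k₂≡k with projectTo W₁ | projectFrom W₂
    ... | h₁ , g₁ , refl | h₂ , g₂ , refl =
      convex c (exit p , entry q , exit∈C p cp , entry∈C q cq , h₁ + h₂ , g₁ ++ᴱ g₂ , geodesic , on-++ᴱ g₁ here)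
      where
      geodesic : IsGeodesic E (g₁ ++ᴱ g₂)
      geodesic m m<h g = geo _ (subst (_ <_) k₁+k₂≡k (framed-< (offset p) (offset q) m<h))
                             (leave p ++ʷ (embed g ++ʷ enter q))

    C⁺-convex : Convex D C⁺
    C⁺-convex (orig c) (_ , _ , cp , cq , _ , W , geo , on) = orig-on-geodesic W geo on cp cq
    C⁺-convex (sub i j e) (_ , _ , cp , cq , _ , W , geo , on) = first , second
      where
      first : C i
      first with sub-preceded W on
      ... | inj₁ refl = proj₁ cp
      ... | inj₂ on' = orig-on-geodesic W geo on' cp cq
      second : C j
      second with sub-followed W on
      ... | inj₁ refl = proj₂ cq
      ... | inj₂ on' = orig-on-geodesic W geo on' cp cq

  project-hullSet : ∀ L → HullSet D (map orig L) → HullSet E L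
  project-hullSet L hull C convex L⊆C x = hull C⁺ C⁺-convex image⊆C⁺ (orig x)
    where
    open Extension C convex
    image⊆C⁺ : ∀ v → v ∈ map orig L → C⁺ v
    image⊆C⁺ v v∈ with ∈-map⁻ orig v∈
    ... | y , y∈L , refl = L⊆C y y∈L

  -- Exchanging subdivision vertices of a hull set (G bipartite)

  -- Each arc of G_{C4} lies on a directed 4-cycle.
  reverseArc : ∀ {u v} → D u v → Reach v u
  reverseArc (out i j e) = 3 , inn i j e ∷ (out j i (sym G i j e) ∷ (inn j i (sym G i j e) ∷ []))
  reverseArc (inn i j e) = 3 , out j i (sym G i j e) ∷ (inn j i (sym G i j e) ∷ (out i j e ∷ []))

  open WalkFacts.Reversible D reverseArc using (ReachableFrom; reachableFrom-convex)

  E? : ∀ u v → Dec (E u v)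
  E? u v = T? (adj G u v)

  -- A convex set containing w and an original vertex a reachable from the
  -- exit of w contains orig (exit w): it is on the geodesic leaving w along a
  -- shortest G-walk to a.
  exit-in-convex : (C : C4Vertex G → Set) → Convex D C → ∀ w a → Σ ℕ (Walk E (exit w) a) →
                   C w → C (orig a) → C (orig (exit w))
  exit-in-convex C convex w a (_ , p) cw ca with minimal (λ m → walk? E? m (exit w) a) p
  ... | m , g , shortest =
    convex _ (w , orig a , cw , ca , offset w + double m , leave w ++ʷ embed g ,
              embedFrom-geodesic w g shortest , on-++ʳ (leave w) here)

  replace : ∀ t R → HullSet D (t ∷ R) → ∀ w → w ∈ R → ∀ a a' {m} (g : Walk E (exit w) a m) →
            IsGeodesic E g → OnWalk E a' g →
            (∀ C → Convex D C → C (orig a) → C (orig a') → C t) → HullSet D (orig a ∷ R)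
  replace t R hull w w∈R a a' {m} g geo on t-between C convex ⊆C = hull C convex t∷R⊆C
    where
    ca = ⊆C (orig a) (here refl)
    c-exit = exit-in-convex C convex w a (m , g) (⊆C w (there w∈R)) ca
    ca' = convex (orig a') (orig (exit w) , orig a , c-exit , ca , double m , embed g ,
                            embedFrom-geodesic (orig (exit w)) g geo , on-embed g on)
    t∷R⊆C : ∀ v → v ∈ t ∷ R → C v
    t∷R⊆C v (here refl) = t-between C convex ca ca'
    t∷R⊆C v (there v∈R) = ⊆C v (there v∈R)

  module Exchange (colour : Fin n → Bool) (proper : ∀ i j → Edge G i j → colour i ≢ colour j) where

    open Parity G colour proper using (extend-nearest)
    open WalkFacts E using (_∷ʳ_; on-∷ʳ; hullSet-⊆)

    -- Some w ∈ R reaches v_x: the hull of v_{x,y} ∷ R is everything, while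
    -- v_{x,y} together with all vertices reachable from R is convex.  Then
    -- v_{x,y} is replaced by the endpoint of xy farther from the exit of w.
    exchange : ∀ x y e R → HullSet D (sub x y e ∷ R) → ∃[ a ] HullSet D (orig a ∷ R)
    exchange x y e R hull
      with hull (ReachableFrom (sub x y e) R) (reachableFrom-convex (sub x y e) R) start (orig x)
      where
      start : ∀ v → v ∈ sub x y e ∷ R → ReachableFrom (sub x y e) R v
      start v (here refl) = inj₁ refl
      start v (there v∈R) = inj₂ (v , v∈R , 0 , [])
    ... | inj₁ ()
    ... | inj₂ (w , w∈R , _ , W) with projectTo W
    ... | _ , to-x , _
      with minimal (λ m → walk? E? m (exit w) x ⊎-dec walk? E? m (exit w) y) (inj₁ to-x)
    ... | m , inj₁ g , nearest =
      y , replace (sub x y e) R hull w w∈R y x (g ∷ʳ e)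
                  (extend-nearest g e (λ j j<m p → nearest j j<m (inj₂ p))) (on-∷ʳ g e)
                  (λ C convex cy cx → sub-between C convex x y e cx cy)
    ... | m , inj₂ g , nearest =
      x , replace (sub x y e) R hull w w∈R x y (g ∷ʳ sym G x y e)
                  (extend-nearest g (sym G x y e) (λ j j<m p → nearest j j<m (inj₁ p))) (on-∷ʳ g _)
                  (λ C convex cx cy → sub-between C convex x y e cx cy)

    to-orig : ∀ t R → HullSet D (t ∷ R) → ∃[ a ] HullSet D (orig a ∷ R)
    to-orig (orig a) R hull = a , hull
    to-orig (sub x y e) R hull = exchange x y e R hull

    -- Exchanging the vertices of a hull set one at a time, moving each
    -- exchanged vertex to the back.
    all-orig : ∀ T done → HullSet D (T ++ map orig done) →
               ∃[ L ] (length L ≡ length T + length done × HullSet D (map orig L))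
    all-orig [] done hull = done , refl , hull
    all-orig (t ∷ T) done hull with to-orig t (T ++ map orig done) hull
    ... | a , hull' with all-orig T (a ∷ done) (hullSet-↭ hull' (↭-sym (shift (orig a) T (map orig done))))
    ... | L , len , hull'' = L , trans len (+-suc (length T) (length done)) , hull''

    project-hullSet-bipartite : ∀ T → HullSet D T → ∃[ S ] (Unique S × length S ≤ length T × HullSet E S)
    project-hullSet-bipartite T hull
      with all-orig T [] (subst (HullSet D) (≡-sym (++-identityʳ T)) hull)
    ... | L , len , hullL =
      deduplicate _≟ᶠ_ L , deduplicate-! _≟ᶠ_ L ,
      ≤-trans (length-deduplicate _≟ᶠ_ L) (≤-reflexive (trans len (+-identityʳ (length T)))) ,
      hullSet-⊆ (project-hullSet L hullL) (∈-deduplicate⁺ _≟ᶠ_)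

hullNumber-transfer :
  ∀ {V W : Set} {A : V → V → Set} {B : W → W → Set} →
  (∀ S → Unique S → HullSet A S → ∃[ T ] (Unique T × length T ≡ length S × HullSet B T)) →
  (∀ T → HullSet B T → ∃[ S ] (Unique S × length S ≤ length T × HullSet A S)) →
  ∀ k → (HullNumber A k → HullNumber B k) × (HullNumber B k → HullNumber A k)
hullNumber-transfer {A = A} {B} lift project k = forward , backward
  where
  forward : HullNumber A k → HullNumber B k
  forward ((S , uS , lenS , hullS) , minA) with lift S uS hullS
  ... | T , uT , lenT , hullT =
    (T , uT , trans lenT lenS , hullT) ,
    λ T' _ hullT' → let (S' , uS' , le , hullS') = project T' hullT' in ≤-trans (minA S' uS' hullS') le

  backward : HullNumber B k → HullNumber A k
  backward ((T , uT , lenT , hullT) , minB) with project T hullT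
  ... | S , uS , le , hullS = (S , uS , ≤-antisym (subst (_ ≤_) lenT le) (minA S uS hullS) , hullS) , minA
    where
    minA : ∀ S' → Unique S' → HullSet A S' → k ≤ length S'
    minA S' uS' hullS' with lift S' uS' hullS'
    ... | T' , uT' , lenT' , hullT' = subst (k ≤_) lenT' (minB T' uT' hullT')


theorem5 : ∀ {n} (G : Graph n) → Bipartite G →
           ∀ (k : ℕ) → (hnG G k → hnGC4 G k) × (hnGC4 G k → hnG G k)
theorem5 G (colour , proper) = hullNumber-transfer lift project-hullSet-bipartite
  where
  open C4 G
  open Exchange colour proper
  lift : ∀ S → Unique S → HullSet E S → ∃[ T ] (Unique T × length T ≡ length S × HullSet D T)
  lift S uS hullS = map orig S , Unique.map⁺ orig-injective uS , length-map orig S , lift-hullSet S hullS
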